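{- Let $G$ be a BDH graph with color classes $X$ and $Y$, with no universal vertex and with at least three vertices. Then $x\in X$ is a cut-vertex of $G$ if and only if $(\{x\},N(x))\in\mathcal{B}(G)$. Analogously, $y\in Y$ is a cut-vertex of $G$ if and only if $(N(y),\{y\})\in\mathcal{B}(G)$.
   Context: A universal vertex is a vertex adjacent to all vertices of the opposite color class. A BDH graph is a bipartite distance hereditary graph, i.e. a bipartite graph $G$ such that for every connected induced subgraph $H$ and all $u,w\in V(H)$, $d_H(u,w)=d_G(u,w)$. A biclique is a pair $(U,W)$ with $U\subseteq X$, $W\subseteq Y$ and every vertex of $U$ adjacent to every vertex of $W$; $\mathcal{B}(G)$ is the set of maximal bicliques, i.e. bicliques $(U,W)$ for which there is no other biclique $(U',W')$ with $U\subseteq U'$ and $W\subseteq W'$. $N(v)$ is the neighborhood of $v$. -}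

module Defs where

open import Level using (0ℓ)
open import Data.Nat using (ℕ; zero; suc; _<_; _≤_; _+_)
open import Data.Fin using (Fin)
open import Data.Bool using (Bool; T)
open import Data.Sum using (_⊎_; inj₁; inj₂)
open import Data.Product using (_×_; ∃; ∃-syntax)
open import Data.Empty using (⊥)
open import Data.Unit using (⊤)
open import Relation.Nullary using (¬_)
open import Relation.Unary using (Pred; _⊆_)
open import Relation.Binary.PropositionalEquality using (_≡_; _≢_)

-- A finite bipartite graph with colour classes X = Fin p and Y = Fin q,
-- given by its (decidable) bipartite adjacency  adj x y.
record BipGraph : Set where
  field
    p q : ℕ
    adj : Fin p → Fin q → Bool

singleton : ∀ {A : Set} → A → Pred A 0ℓ
singleton a b = b ≡ a

module _ (G : BipGraph) where
  open BipGraph G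

  V : Set
  V = Fin p ⊎ Fin q

  Adj : V → V → Set
  Adj (inj₁ x) (inj₂ y) = T (adj x y)
  Adj (inj₂ y) (inj₁ x) = T (adj x y)
  Adj _        _        = ⊥

  -- walk of length k from u to w all of whose vertices lie in S
  -- (i.e. a walk in the induced subgraph G[S])
  data Walk (S : Pred V 0ℓ) : V → V → ℕ → Set where
    here : ∀ {u} → S u → Walk S u u 0
    step : ∀ {u v w k} → S u → Adj u v → Walk S v w k → Walk S u w (suc k)

  Whole : Pred V 0ℓ
  Whole _ = ⊤

  DistIn : Pred V 0ℓ → V → V → ℕ → Set
  DistIn S u w k = Walk S u w k × (∀ j → j < k → ¬ Walk S u w j)

  ConnectedIn : Pred V 0ℓ → Set
  ConnectedIn S = ∀ u w → S u → S w → ∃[ k ] Walk S u w k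

  Connected : Set
  Connected = ConnectedIn Whole

  DistanceHereditary : Set₁
  DistanceHereditary =
    ∀ (S : Pred V 0ℓ) → ConnectedIn S →
    ∀ u w → S u → S w → ∀ k → (DistIn S u w k → DistIn Whole u w k)
                               × (DistIn Whole u w k → DistIn S u w k)

  -- BDH graph (bipartiteness is built into the representation;
  -- distance hereditary graphs are connected by convention)
  BDH : Set₁
  BDH = Connected × DistanceHereditary

  UniversalX : Fin p → Set
  UniversalX x = ∀ y → T (adj x y)

  UniversalY : Fin q → Set
  UniversalY y = ∀ x → T (adj x y)

  NoUniversalVertex : Set
  NoUniversalVertex = (∀ x → ¬ UniversalX x) × (∀ y → ¬ UniversalY y)

  order : ℕ
  order = p + q

  IsCutVertex : V → Set
  IsCutVertex v = ∃[ a ] ∃[ b ] (a ≢ v × b ≢ v × (∀ k → ¬ Walk (λ z → z ≢ v) a b k))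

  IsBiclique : Pred (Fin p) 0ℓ → Pred (Fin q) 0ℓ → Set
  IsBiclique U W = ∀ x y → U x → W y → T (adj x y)

  IsMaximalBiclique : Pred (Fin p) 0ℓ → Pred (Fin q) 0ℓ → Set₁
  IsMaximalBiclique U W =
    IsBiclique U W ×
    (∀ (U' : Pred (Fin p) 0ℓ) (W' : Pred (Fin q) 0ℓ) →
       IsBiclique U' W' → U ⊆ U' → W ⊆ W' → (U' ⊆ U × W' ⊆ W))

  NX : Fin p → Pred (Fin q) 0ℓ
  NX x y = T (adj x y)

  NY : Fin q → Pred (Fin p) 0ℓ
  NY y x = T (adj x y)

module Submission where

-- The pivot is domination.  Call x ∈ X undominated if N(x) ⊆ N(x') forces x' = x.
--  * ({x}, N(x)) is a maximal biclique iff x is undominated: a dominating x' ≠ x gives the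
--    larger biclique ({x,x'}, N(x)), and conversely.
--  * A cut vertex is undominated: if N(x) ⊆ N(x'), x' ≠ x, every walk can be rerouted
--    through x' instead of x, so G - x stays connected.
--  * An undominated, non-universal x is a cut vertex.  Here distance heredity enters:
--    starting at a vertex z at distance two from x, follow "bridges" z–a–w–y to vertices
--    y ∈ N(x) \ N(z) avoiding x.  Distance heredity on the induced path z–y'–x–y–w shows that
--    N(x) \ N(w) ⊊ N(x) \ N(z), so this terminates; it stops either because N(x) ⊆ N(z)
--    (impossible, x being undominated) or because there is no bridge, and then x separates
--    z from y (a walk avoiding x could be shortened to a bridge, again by distance heredity).

open import Defs
open import Level using (0ℓ)
open import Data.Nat using (suc; _+_; _≤_; _<_; s≤s)
open import Data.Nat.Induction using (<-wellFounded)
open import Data.Fin using (Fin)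
open import Data.Fin.Properties using (_≟_; any?; ¬∀⟶∃¬)
open import Data.Fin.Subset using (Subset; _∈_; _⊂_; ∣_∣)
open import Data.Fin.Subset.Properties using (_∈?_; p⊂q⇒∣p∣<∣q∣)
open import Data.Vec using (tabulate)
open import Data.Vec.Properties using (lookup∘tabulate; []=⇒lookup; lookup⇒[]=)
open import Data.Bool using (Bool; true; false; T; _∧_; not)
open import Data.Bool.Properties using (T-≡)
open import Data.List using ([]; _∷_)
open import Data.List.Membership.Propositional using () renaming (_∈_ to _∈ᴸ_)
open import Data.List.Relation.Unary.Any using (here; there)
open import Data.Sum using (inj₁; inj₂; _⊎_; swap)
open import Data.Sum.Properties using (swap-involutive; inj₁-injective)
import Data.Product as Product
open import Data.Product using (_×_; _,_; proj₁; proj₂; ∃; ∃-syntax)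
open import Data.Empty using (⊥-elim)
open import Data.Unit using (tt)
open import Function using (_∘_; id)
open import Function.Bundles using (_⇔_; mk⇔; Equivalence)
open import Function.Construct.Composition using (_⇔-∘_)
open import Induction.WellFounded using (Acc; acc)
open import Relation.Nullary using (¬_; Dec; yes; no)
open import Relation.Nullary.Decidable using (T?; ¬?; _×-dec_; decidable-stable)
open import Relation.Unary using (Pred; Decidable; _⊆_)
open import Relation.Binary.PropositionalEquality
  using (_≡_; _≢_; refl; sym; trans; cong; subst; subst₂)

open Equivalence using (to; from)

∈-tabulate : ∀ {n} {f : Fin n → Bool} {i} → i ∈ tabulate f ⇔ T (f i)
∈-tabulate {f = f} {i} = mk⇔
  (λ i∈f → from T-≡ (trans (sym (lookup∘tabulate f i)) ([]=⇒lookup i∈f)))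
  (λ t → lookup⇒[]= i (tabulate f) (trans (lookup∘tabulate f i) (to T-≡ t)))

T-∧-not : ∀ {a b} → T (a ∧ not b) ⇔ (T a × ¬ T b)
T-∧-not {true}  {false} = mk⇔ (λ _ → tt , λ ()) (λ _ → tt)
T-∧-not {true}  {true}  = mk⇔ (λ ()) (λ (_ , ¬t) → ¬t tt)
T-∧-not {false} {_}     = mk⇔ (λ ()) proj₁

mapWalk : ∀ {G H : BipGraph} {R : Pred (V G) 0ℓ} {R' : Pred (V H) 0ℓ} (f : V G → V H) →
          (∀ u v → Adj G u v → Adj H (f u) (f v)) → (∀ {v} → R v → R' (f v)) →
          ∀ {u w k} → Walk G R u w k → Walk H R' (f u) (f w) k
mapWalk f hom inR (here r)     = here (inR r)
mapWalk f hom inR (step r e W) = step (inR r) (hom _ _ e) (mapWalk f hom inR W)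

module Walks (G : BipGraph) where

  adj-sym : ∀ {u v} → Adj G u v → Adj G v u
  adj-sym {inj₁ _} {inj₂ _} e = e
  adj-sym {inj₂ _} {inj₁ _} e = e

  walk-first : ∀ {S u v k} → Walk G S u v k → S u
  walk-first (here s)     = s
  walk-first (step s _ _) = s

  walk-last : ∀ {S u v k} → Walk G S u v k → S v
  walk-last (here s)     = s
  walk-last (step _ _ W) = walk-last W

  snoc : ∀ {S u v w k} → Walk G S u v k → Adj G v w → S w → Walk G S u w (suc k)
  snoc (here s)      e sw = step s e (here sw)
  snoc (step s e' W) e sw = step s e' (snoc W e sw)

  reverse : ∀ {S u v k} → Walk G S u v k → Walk G S v u k
  reverse (here s)                     = here s
  reverse {u = u} (step {v = v} s e W) = snoc (reverse W) (adj-sym {u} {v} e) s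

  _++_ : ∀ {S u v w k j} → Walk G S u v k → Walk G S v w j → Walk G S u w (k + j)
  here _     ++ W' = W'
  step s e W ++ W' = step s e (W ++ W')

  exit-edge : ∀ {A : Pred (V G) 0ℓ} {S u v k} → Decidable A → A u → ¬ A v → Walk G S u v k →
              ∃[ a ] ∃[ b ] (Adj G a b × A a × ¬ A b)
  exit-edge A? au ¬av (here _) = ⊥-elim (¬av au)
  exit-edge {u = u} A? au ¬av (step {v = w} _ e W) with A? w
  ... | yes aw  = exit-edge A? aw ¬av W
  ... | no  ¬aw = u , w , e , au , ¬aw

  Component : Pred (V G) 0ℓ → V G → Pred (V G) 0ℓ
  Component S z v = ∃[ j ] Walk G S z v j

  within-component : ∀ {S z u v k} → Component S z u → Walk G S u v k → Walk G (Component S z) u v k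
  within-component c       (here _)     = here c
  within-component (j , P) (step s e W) =
    step (j , P) e (within-component (suc j , snoc P e (walk-first W)) W)

  component-connected : ∀ S z → ConnectedIn G (Component S z)
  component-connected S z u w (_ , P) (_ , Q) = _ , reverse (from-z P) ++ from-z Q
    where
    from-z : ∀ {v j} → Walk G S z v j → Walk G (Component S z) z v j
    from-z P = within-component (0 , here (walk-first P)) P

-- Distance heredity, applied to the component of u in G[S]: vertices joined by a walk inside S
-- are joined inside S by a walk whose length is their distance in G.
geodesic-within : ∀ {G} → DistanceHereditary G → ∀ {S u v k m} →
                  Walk G S u v k → DistIn G (Whole G) u v m → Walk G S u v m
geodesic-within {G} dh {S} {u} {v} {k} {m} W d =
  mapWalk id (λ _ _ e → e) (walk-last ∘ proj₂)
    (proj₁ (proj₂ (dh (Component S u) (component-connected S u) u v (0 , here (walk-first W)) (k , W) m) d))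
  where open Walks G

-- The transpose Gᵀ exchanges the colour classes; note (G ᵀ) ᵀ is G definitionally.
_ᵀ : BipGraph → BipGraph
G ᵀ = record { p = q ; q = p ; adj = λ y x → adj x y }
  where open BipGraph G

swap-adj : ∀ {G} u v → Adj G u v → Adj (G ᵀ) (swap u) (swap v)
swap-adj (inj₁ _) (inj₂ _) e = e
swap-adj (inj₂ _) (inj₁ _) e = e

walk-transpose : ∀ {G S u w k} → Walk (G ᵀ) S u w k ⇔ Walk G (S ∘ swap) (swap u) (swap w) k
walk-transpose {G} {S} {u} {w} {k} = mk⇔
  (mapWalk swap (swap-adj {G ᵀ}) (λ {v} s → subst S (sym (swap-involutive v)) s))
  (λ W → subst₂ (λ a b → Walk (G ᵀ) S a b k) (swap-involutive u) (swap-involutive w)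
                (mapWalk swap (swap-adj {G}) id W))

dist-transpose : ∀ {G S u w k} → DistIn (G ᵀ) S u w k ⇔ DistIn G (S ∘ swap) (swap u) (swap w) k
dist-transpose = mk⇔
  (λ (W , shortest) → to walk-transpose W , λ j j<k W' → shortest j j<k (from walk-transpose W'))
  (λ (W , shortest) → from walk-transpose W , λ j j<k W' → shortest j j<k (to walk-transpose W'))

connected-transpose : ∀ {G S} → ConnectedIn G S → ConnectedIn (G ᵀ) (S ∘ swap)
connected-transpose {G} {S} conn u w su sw with conn (swap u) (swap w) su sw
... | k , W = k , subst₂ (λ a b → Walk (G ᵀ) (S ∘ swap) a b k)
                         (swap-involutive u) (swap-involutive w) (to (walk-transpose {G ᵀ}) W)

bdh-transpose : ∀ {G} → BDH G → BDH (G ᵀ)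
bdh-transpose {G} (conn , dh) = connected-transpose conn , dh-transpose
  where
  dh-transpose : DistanceHereditary (G ᵀ)
  dh-transpose S conn-S u w su sw k
    with dh (S ∘ swap) (connected-transpose conn-S) (swap u) (swap w)
            (subst S (sym (swap-involutive u)) su) (subst S (sym (swap-involutive w)) sw) k
  ... | to-whole , from-whole =
    (λ d → from dist-transpose (to-whole (to dist-transpose d))) ,
    (λ d → from dist-transpose (from-whole (to dist-transpose d)))

no-universal-transpose : ∀ {G} → NoUniversalVertex G → NoUniversalVertex (G ᵀ)
no-universal-transpose = Product.swap

cut-transpose : ∀ {G v} → IsCutVertex G v → IsCutVertex (G ᵀ) (swap v)
cut-transpose {G} {v} (a , b , a≢v , b≢v , separated) =
  swap a , swap b , swap-≢ a≢v , swap-≢ b≢v , λ k W → separated k (unswap W)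
  where
  swap-≢ : ∀ {a} → a ≢ v → swap a ≢ swap v
  swap-≢ {a} a≢v eq = a≢v (trans (sym (swap-involutive a)) (trans (cong swap eq) (swap-involutive v)))
  unswap : ∀ {k} → Walk (G ᵀ) (_≢ swap v) (swap a) (swap b) k → Walk G (_≢ v) a b k
  unswap {k} W = subst₂ (λ c d → Walk G (_≢ v) c d k) (swap-involutive a) (swap-involutive b)
    (mapWalk swap (swap-adj {G ᵀ}) (λ {z} z≢v eq → z≢v (trans (sym (swap-involutive z)) (cong swap eq))) W)

maximal-transpose : ∀ {G U W} → IsMaximalBiclique G U W → IsMaximalBiclique (G ᵀ) W U
maximal-transpose (bic , maximal) =
  (λ y x w u → bic x y u w) ,
  λ W' U' bic' W⊆ U⊆ → Product.swap (maximal U' W' (λ x y u w → bic' y x w u) U⊆ W⊆)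

module XSide (G : BipGraph) where
  open BipGraph G
  open Walks G

  Undominated : Fin p → Set
  Undominated x = ∀ x' → NX G x ⊆ NX G x' → x' ≡ x

  -- ({x}, N(x)) is maximal iff x is undominated: a dominating x' would give ({x,x'}, N(x)).
  undominated⇔maximal : ∀ x → Undominated x ⇔ IsMaximalBiclique G (singleton x) (NX G x)
  undominated⇔maximal x = mk⇔ maximal undominated
    where
    star : IsBiclique G (singleton x) (NX G x)
    star _ _ refl xy = xy
    maximal : Undominated x → IsMaximalBiclique G (singleton x) (NX G x)
    maximal undom = star , λ U W bic x∈U N⊆W →
      (λ {x'} x'∈U → undom x' (λ xy → bic x' _ x'∈U (N⊆W xy))) ,
      (λ y∈W → bic x _ (x∈U refl) y∈W)
    undominated : IsMaximalBiclique G (singleton x) (NX G x) → Undominated x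
    undominated (_ , maximal) x' dom = proj₁ (maximal Pair (NX G x) pair-star inj₁ id) (inj₂ refl)
      where
      Pair : Pred (Fin p) 0ℓ
      Pair v = v ≡ x ⊎ v ≡ x'
      pair-star : IsBiclique G Pair (NX G x)
      pair-star _ _ (inj₁ refl) xy = xy
      pair-star _ _ (inj₂ refl) xy = dom xy

  module Rerouting {x x' : Fin p} (dom : NX G x ⊆ NX G x') where
    replace : V G → V G
    replace (inj₁ z) with z ≟ x
    ... | yes _ = inj₁ x'
    ... | no  _ = inj₁ z
    replace (inj₂ y) = inj₂ y

    replace-adj : ∀ u v → Adj G u v → Adj G (replace u) (replace v)
    replace-adj (inj₁ z) (inj₂ y) e with z ≟ x
    ... | yes refl = dom e
    ... | no  _    = e
    replace-adj (inj₂ y) (inj₁ z) e with z ≟ x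
    ... | yes refl = dom e
    ... | no  _    = e

    replace-avoids : x' ≢ x → ∀ v → replace v ≢ inj₁ x
    replace-avoids x'≢x (inj₁ z) with z ≟ x
    ... | yes _   = x'≢x ∘ inj₁-injective
    ... | no  z≢x = z≢x ∘ inj₁-injective
    replace-avoids x'≢x (inj₂ y) ()

    replace-fixes : ∀ {v} → v ≢ inj₁ x → replace v ≡ v
    replace-fixes {inj₁ z} v≢x with z ≟ x
    ... | yes refl = ⊥-elim (v≢x refl)
    ... | no  _    = refl
    replace-fixes {inj₂ y} _ = refl

  -- If N(x) ⊆ N(x') with x' ≠ x, rerouting walks through x' shows that G - x is connected.
  rerouting : Connected G → ∀ {x x'} → x' ≢ x → NX G x ⊆ NX G x' → ¬ IsCutVertex G (inj₁ x)
  rerouting conn {x} x'≢x dom (a , b , a≢x , b≢x , separated) with conn a b tt tt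
  ... | k , W = separated k (subst₂ (λ c d → Walk G (_≢ inj₁ x) c d k) (replace-fixes a≢x) (replace-fixes b≢x)
                                    (mapWalk replace replace-adj (λ {v} _ → replace-avoids x'≢x v) W))
    where open Rerouting dom

  cut⇒undominated : Connected G → ∀ {x} → IsCutVertex G (inj₁ x) → Undominated x
  cut⇒undominated conn {x} cut x' dom = decidable-stable (x' ≟ x) (λ x'≢x → rerouting conn x'≢x dom cut)

  middle₂ : ∀ {S z w} → Walk G S (inj₁ z) (inj₁ w) 2 → ∃[ b ] (T (adj z b) × T (adj w b) × S (inj₂ b))
  middle₂ (step {v = inj₁ _} _ () _)
  middle₂ (step {v = inj₂ b} _ zb (step sb wb (here _))) = b , zb , wb , sb

  middle₃ : ∀ {S z y} → Walk G S (inj₁ z) (inj₂ y) 3 →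
            ∃[ a ] ∃[ w ] (T (adj z a) × T (adj w a) × T (adj w y) × S (inj₁ w))
  middle₃ (step {v = inj₁ _} _ () _)
  middle₃ (step {v = inj₂ _} _ _ (step {v = inj₂ _} _ () _))
  middle₃ (step {v = inj₂ a} _ za (step {v = inj₁ w} _ wa (step sw wy (here _)))) = a , w , za , wa , wy , sw

  distance-two : ∀ {z w a} → z ≢ w → T (adj z a) → T (adj w a) → DistIn G (Whole G) (inj₁ z) (inj₁ w) 2
  distance-two {z} {w} {a} z≢w za wa = step {v = inj₂ a} tt za (step tt wa (here tt)) , no-shorter
    where
    no-shorter : ∀ j → j < 2 → ¬ Walk G (Whole G) (inj₁ z) (inj₁ w) j
    no-shorter 0 _ (here _)                = z≢w refl
    no-shorter 1 _ (step _ () (here _))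
    no-shorter (suc (suc _)) (s≤s (s≤s ()))

  -- A path z – a – w – y with z ≁ y realises the distance three (by parity, nothing shorter).
  distance-three : ∀ {z a w y} → T (adj z a) → T (adj w a) → T (adj w y) → ¬ T (adj z y) →
                   DistIn G (Whole G) (inj₁ z) (inj₂ y) 3
  distance-three {z} {a} {w} {y} za wa wy z≁y =
    step {v = inj₂ a} tt za (step {v = inj₁ w} tt wa (step tt wy (here tt))) , no-shorter
    where
    no-shorter : ∀ j → j < 3 → ¬ Walk G (Whole G) (inj₁ z) (inj₂ y) j
    no-shorter 0 _ ()
    no-shorter 1 _ (step _ zy (here _))                = z≁y zy
    no-shorter 2 _ (step {v = inj₁ _} _ () _)
    no-shorter 2 _ (step {v = inj₂ _} _ _ (step _ () (here _)))
    no-shorter (suc (suc (suc _))) (s≤s (s≤s (s≤s ())))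

  -- The induced path z – y' – x – y – w must contain a common neighbour of z and w,
  -- since d(z,w) = 2; it cannot be y, so it is y'.
  neighbour-transfer : DistanceHereditary G → ∀ {x z w a y y'} →
                       T (adj z a) → T (adj w a) → T (adj w y) → T (adj x y) → ¬ T (adj z y) →
                       T (adj x y') → T (adj z y') → T (adj w y')
  neighbour-transfer dh {x} {z} {w} {a} {y} {y'} za wa wy xy z≁y xy' zy' =
    common (middle₂ (geodesic-within dh path (distance-two z≢w za wa)))
    where
    z≢w : z ≢ w
    z≢w refl = z≁y wy
    OnPath : Pred (V G) 0ℓ
    OnPath v = v ∈ᴸ (inj₁ z ∷ inj₂ y' ∷ inj₁ x ∷ inj₂ y ∷ inj₁ w ∷ [])
    path : Walk G OnPath (inj₁ z) (inj₁ w) 4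
    path = step {v = inj₂ y'} (here refl) zy'
             (step {v = inj₁ x} (there (here refl)) xy'
               (step {v = inj₂ y} (there (there (here refl))) xy
                 (step (there (there (there (here refl)))) wy
                   (here (there (there (there (there (here refl)))))))))
    common : ∃[ b ] (T (adj z b) × T (adj w b) × OnPath (inj₂ b)) → T (adj w y')
    common (_ , _  , wy' , there (here refl))                 = wy'
    common (_ , zy , _   , there (there (there (here refl)))) = ⊥-elim (z≁y zy)
    common (_ , _  , _   , here ())
    common (_ , _  , _   , there (there (here ())))
    common (_ , _  , _   , there (there (there (there (here ())))))
    common (_ , _  , _   , there (there (there (there (there ())))))

  module Separation (conn : Connected G) (dh : DistanceHereditary G) (x : Fin p) where

    Missing : Fin p → Subset q
    Missing z = tabulate (λ y → adj x y ∧ not (adj z y))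

    ∈-Missing : ∀ {z y} → y ∈ Missing z ⇔ (T (adj x y) × ¬ T (adj z y))
    ∈-Missing = T-∧-not ⇔-∘ ∈-tabulate

    SecondNeighbour : Fin p → Set
    SecondNeighbour z = z ≢ x × ∃[ y ] (T (adj x y) × T (adj z y))

    Closed : Pred (V G) 0ℓ
    Closed (inj₁ z) = z ≡ x
    Closed (inj₂ y) = T (adj x y)

    closed? : Decidable Closed
    closed? (inj₁ z) = z ≟ x
    closed? (inj₂ y) = T? (adj x y)

    -- A walk from x to a non-neighbour leaves N[x] along an edge from N(x) to a second neighbour.
    second-neighbour : ¬ UniversalX G x → ∃ SecondNeighbour
    second-neighbour non-universal
      with ¬∀⟶∃¬ q (λ y → T (adj x y)) (λ y → T? (adj x y)) non-universal
    ... | y , x≁y with exit-edge closed? refl x≁y (proj₂ (conn (inj₁ x) (inj₂ y) tt tt))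
    ... | inj₂ y' , inj₁ z , zy' , xy' , z≢x = z , z≢x , y' , xy' , zy'
    ... | inj₁ _  , inj₂ _ , xy' , refl , x≁y' = ⊥-elim (x≁y' xy')
    ... | inj₁ _  , inj₁ _ , () , _
    ... | inj₂ _  , inj₂ _ , () , _

    Bridge : Fin p → Fin q → Set
    Bridge z y = ∃[ a ] ∃[ w ] (T (adj z a) × T (adj w a) × T (adj w y) × w ≢ x)

    bridge? : ∀ z y → Dec (Bridge z y)
    bridge? z y = any? λ a → any? λ w →
      T? (adj z a) ×-dec T? (adj w a) ×-dec T? (adj w y) ×-dec ¬? (w ≟ x)

    bridge-shrinks : ∀ {z y a w} → T (adj x y) → ¬ T (adj z y) →
                     T (adj z a) → T (adj w a) → T (adj w y) → Missing w ⊂ Missing z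
    bridge-shrinks xy z≁y za wa wy =
      (λ y'∈ → let (xy' , w≁y') = to ∈-Missing y'∈ in
        from ∈-Missing (xy' , λ zy' → w≁y' (neighbour-transfer dh za wa wy xy z≁y xy' zy'))) ,
      _ , from ∈-Missing (xy , z≁y) , λ y∈ → proj₂ (to ∈-Missing y∈) wy

    -- Without a bridge, x separates z from y: a walk avoiding x could be shortened
    -- to length d(z,y) = 3, i.e. to a bridge.
    no-bridge⇒cut : ∀ {z y} → SecondNeighbour z → T (adj x y) → ¬ T (adj z y) → ¬ Bridge z y →
                    IsCutVertex G (inj₁ x)
    no-bridge⇒cut {z} {y} (z≢x , y₀ , xy₀ , zy₀) xy z≁y no-bridge =
      inj₁ z , inj₂ y , z≢x ∘ inj₁-injective , (λ ()) , no-walk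
      where
      no-walk : ∀ k → ¬ Walk G (_≢ inj₁ x) (inj₁ z) (inj₂ y) k
      no-walk k W with middle₃ (geodesic-within dh W (distance-three zy₀ xy₀ xy z≁y))
      ... | a , w , za , wa , wy , w≢x = no-bridge (a , w , za , wa , wy , w≢x ∘ cong inj₁)

    descend : Undominated x → ∀ z → Acc _<_ ∣ Missing z ∣ → SecondNeighbour z → IsCutVertex G (inj₁ x)
    descend undom z (acc smaller) sn@(z≢x , _) with any? (_∈? Missing z)
    ... | no nothing-missing = ⊥-elim (z≢x (undom z dominated))
      where
      dominated : NX G x ⊆ NX G z
      dominated {y} xy = decidable-stable (T? (adj z y))
                           (λ z≁y → nothing-missing (y , from ∈-Missing (xy , z≁y)))
    ... | yes (y , y∈) with to ∈-Missing y∈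
    ...   | xy , z≁y with bridge? z y
    ...     | no no-bridge = no-bridge⇒cut sn xy z≁y no-bridge
    ...     | yes (a , w , za , wa , wy , w≢x) =
      descend undom w (smaller (p⊂q⇒∣p∣<∣q∣ (bridge-shrinks xy z≁y za wa wy))) (w≢x , y , xy , wy)

    undominated⇒cut : ¬ UniversalX G x → Undominated x → IsCutVertex G (inj₁ x)
    undominated⇒cut non-universal undom with second-neighbour non-universal
    ... | z , sn = descend undom z (<-wellFounded _) sn

  cut⇔undominated : BDH G → ∀ {x} → ¬ UniversalX G x → IsCutVertex G (inj₁ x) ⇔ Undominated x
  cut⇔undominated (conn , dh) {x} non-universal =
    mk⇔ (cut⇒undominated conn) (Separation.undominated⇒cut conn dh x non-universal)

  cut⇔maximal : BDH G → NoUniversalVertex G →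
                ∀ x → IsCutVertex G (inj₁ x) ⇔ IsMaximalBiclique G (singleton x) (NX G x)
  cut⇔maximal bdh (non-universal , _) x =
    undominated⇔maximal x ⇔-∘ cut⇔undominated bdh (non-universal x)

-- The Y side of G is the X side of Gᵀ.
y-side-from-transpose : ∀ G →
  (∀ y → IsCutVertex (G ᵀ) (inj₁ y) ⇔ IsMaximalBiclique (G ᵀ) (singleton y) (NX (G ᵀ) y)) →
  ∀ y → IsCutVertex G (inj₂ y) ⇔ IsMaximalBiclique G (NY G y) (singleton y)
y-side-from-transpose G x-side y = mk⇔
  (λ cut → maximal-transpose {G ᵀ} (to (x-side y) (cut-transpose {G} cut)))
  (λ max → cut-transpose {G ᵀ} (from (x-side y) (maximal-transpose {G} max)))

lemma3 : (G : BipGraph) → BDH G → NoUniversalVertex G → 3 ≤ order G →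
         (∀ x → IsCutVertex G (inj₁ x) ⇔ IsMaximalBiclique G (singleton x) (NX G x))
         × (∀ y → IsCutVertex G (inj₂ y) ⇔ IsMaximalBiclique G (NY G y) (singleton y))
lemma3 G bdh no-universal _ =
  XSide.cut⇔maximal G bdh no-universal ,
  y-side-from-transpose G
    (XSide.cut⇔maximal (G ᵀ) (bdh-transpose bdh) (no-universal-transpose {G} no-universal))
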